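{- Let $\mathcal G$ be a simple directed graph, $d\ge 1$, and let $\bar\sigma$ be a $d$-simplex of $\mathcal G$. Then $\bar\sigma$ contains exactly $\binom{d+1}{2}$ almost-$d$-simplices which complete to $\bar\sigma$.
   Context: A simple directed graph is a pair $\mathcal G=(V,E)$ with $V$ finite and $E\subseteq (V\times V)\setminus\{(v,v):v\in V\}$ (reciprocal edges allowed, no self-loops). A $d$-simplex of $\mathcal G$ is a tuple $\sigma=(v_0,\dots,v_d)$ of distinct vertices with $(v_i,v_j)\in E$ for all $0\le i<j\le d$; $\mathrm{Ver}(\sigma)=\{v_0,\dots,v_d\}$, $\mathrm{Edg}(\sigma)=\{(v_i,v_j):0\le i<j\le d\}$. For $i\in\{0,\dots,d\}$, $\partial_i(v_0,\dots,v_d)=(v_0,\dots,v_{i-1},v_{i+1},\dots,v_d)$. For $d\ge2$, an almost-$d$-simplex is a tuple $(\{\sigma,\sigma'\},e)$ where $\sigma=(v_0,\dots,v_{d-1})$, $\sigma'=(v'_0,\dots,v'_{d-1})$ are $(d-1)$-simplices and $e$ is an ordered pair of vertices (not necessarily an edge) such that for some $i,i'\in\{0,\dots,d-1\}$: (1) $\partial_i(\sigma)=\partial_{i'}(\sigma')$, (2) $v_i\neq v'_{i'}$, (3) $e=(v_i,v'_{i'})$ (allowed only if $i\le i'$) or $e=(v'_{i'},v_i)$ (allowed only if $i'\le i$). For $d=1$ an almost-1-simplex is $(\{v,v'\},(v,v'))$ with $v\ne v'$. For an almost-$d$-simplex $(\{\sigma,\sigma'\},e)$, the graph with vertex set $\mathrm{Ver}(\sigma)\cup\mathrm{Ver}(\sigma')$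 and edge set $\mathrm{Edg}(\sigma)\cup\mathrm{Edg}(\sigma')\cup\{e\}$ has exactly one $d$-simplex in its flag complex; the almost-$d$-simplex is said to complete to that $d$-simplex. An almost-$d$-simplex is contained in $\bar\sigma$ if $\sigma,\sigma'$ and $e$ are a subgraph (vertices and edges) of $\bar\sigma$. -}

module Defs where

open import Data.Nat using (ℕ; zero; suc; _≤_; _<_)
open import Data.Fin using (Fin; toℕ)
open import Data.Vec using (Vec; lookup; removeAt; _∷_; [])
open import Data.Vec.Membership.Propositional using (_∈_)
open import Data.Product using (Σ; ∃; ∃-syntax; _×_; _,_)
open import Data.Sum using (_⊎_)
open import Data.Empty using (⊥)
open import Data.Unit using (⊤)
open import Relation.Nullary using (¬_)
open import Relation.Binary.PropositionalEquality using (_≡_; _≢_)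

-- A simple directed graph: finite vertex set V = Fin n, edge relation E
-- without self-loops (reciprocal edges allowed).
record SimpleDigraph : Set₁ where
  field
    n      : ℕ
    E      : Fin n → Fin n → Set
    noLoop : ∀ v → ¬ E v v

module _ {V : Set} where

  -- A "graph" given by a vertex predicate and an edge predicate on V.
  -- σ : Vec V (suc d) is a d-simplex of it if its vertices are distinct,
  -- lie in the vertex set, and (v_i , v_j) is an edge for all i < j.
  IsSimplexIn : (V → Set) → (V → V → Set) → ∀ {m} → Vec V m → Set
  IsSimplexIn Vp Ep σ =
      (∀ i j → lookup σ i ≡ lookup σ j → i ≡ j)
    × (∀ i → Vp (lookup σ i))
    × (∀ i j → toℕ i < toℕ j → Ep (lookup σ i) (lookup σ j))

  Edg : ∀ {m} → Vec V m → V → V → Set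
  Edg σ a b = ∃[ i ] ∃[ j ] (toℕ i < toℕ j × lookup σ i ≡ a × lookup σ j ≡ b)

  -- A presentation (σ, σ', e) of an almost-d-simplex ({σ,σ'}, e):
  -- σ and σ' are (d-1)-simplices, i.e. tuples of d vertices.
  record Pres (d : ℕ) : Set where
    constructor pres
    field
      σ₁ : Vec V d
      σ₂ : Vec V d
      e  : V × V

  open Pres public

  SameAlmost : ∀ {d} → Pres d → Pres d → Set
  SameAlmost p q =
    ((σ₁ p ≡ σ₁ q × σ₂ p ≡ σ₂ q) ⊎ (σ₁ p ≡ σ₂ q × σ₂ p ≡ σ₁ q)) × e p ≡ e q

  AlmostCond : ∀ {d} → (V → V → Set) → Pres d → Set
  AlmostCond {zero} E p = ⊥
  -- d = 1 : ({v,v'},(v,v')) with v ≠ v'; since {v,v'} is unordered, a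
  -- presentation with σ₁ = (v), σ₂ = (v') may carry either orientation.
  AlmostCond {suc zero} E (pres (v ∷ []) (v' ∷ []) e) =
    v ≢ v' × (e ≡ (v , v') ⊎ e ≡ (v' , v))
  AlmostCond {suc (suc k)} E (pres σ σ' e) =
      IsSimplexIn (λ _ → ⊤) E σ
    × IsSimplexIn (λ _ → ⊤) E σ'
    × ∃[ i ] ∃[ i' ]
        ( removeAt σ i ≡ removeAt σ' i'
        × lookup σ i ≢ lookup σ' i'
        × ( (e ≡ (lookup σ i , lookup σ' i') × toℕ i ≤ toℕ i')
          ⊎ (e ≡ (lookup σ' i' , lookup σ i) × toℕ i' ≤ toℕ i)))

  SpanVer : ∀ {d} → Pres d → V → Set
  SpanVer p v = v ∈ σ₁ p ⊎ v ∈ σ₂ p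

  SpanEdg : ∀ {d} → Pres d → V → V → Set
  SpanEdg p a b = Edg (σ₁ p) a b ⊎ Edg (σ₂ p) a b ⊎ e p ≡ (a , b)

  -- The almost-d-simplex completes to the d-simplex τ: τ is the d-simplex of
  -- the flag complex of the spanned graph (which has exactly one d-simplex).
  CompletesTo : ∀ {d} → Pres d → Vec V (suc d) → Set
  CompletesTo p τ = IsSimplexIn (SpanVer p) (SpanEdg p) τ

  ContainedIn : ∀ {d m} → Pres d → Vec V m → Set
  ContainedIn p τ =
      (∀ v → v ∈ σ₁ p → v ∈ τ)
    × (∀ v → v ∈ σ₂ p → v ∈ τ)
    × (∀ a b → Edg (σ₁ p) a b → Edg τ a b)
    × (∀ a b → Edg (σ₂ p) a b → Edg τ a b)
    × (Σ (V × V) λ { (a , b) → e p ≡ (a , b) × a ∈ τ × b ∈ τ × Edg τ a b })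

IsSimplex : (G : SimpleDigraph) → ∀ {m} → Vec (Fin (SimpleDigraph.n G)) m → Set
IsSimplex G σ = IsSimplexIn (λ _ → ⊤) (SimpleDigraph.E G) σ

IsAlmostSimplex : (G : SimpleDigraph) → ∀ {d} → Pres {Fin (SimpleDigraph.n G)} d → Set
IsAlmostSimplex G p = AlmostCond (SimpleDigraph.E G) p

-- Write σ̄ = (v₀, …, v_d). If an almost-d-simplex ({σ, σ′}, e) is contained in σ̄, then σ and σ′,
-- being d-vertex subgraphs of σ̄ carrying all their edges, are faces ∂_m σ̄ and ∂_m′ σ̄. Sharing the
-- facet ∂ᵢ σ = ∂ᵢ′ σ′ with σᵢ ≠ σ′ᵢ′ forces m ≠ m′, σᵢ = v_m′ and σ′ᵢ′ = v_m, so e joins v_m and v_m′,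
-- and since e is an edge of σ̄ it points from the smaller index to the larger. Hence these
-- almost-simplices are exactly ({∂_b σ̄, ∂_a σ̄}, (v_a, v_b)) for a < b, and each of them completes
-- to σ̄; there are C(d+1, 2) such pairs.
module Submission where

open import Defs
open import Data.Nat using (ℕ; suc; _≤_)
open import Data.Nat.Combinatorics using (_C_)
open import Data.Fin using (Fin)
open import Data.Vec using (Vec)
open import Data.Product using (Σ; ∃-syntax; _×_)
open import Relation.Binary.PropositionalEquality using (_≡_)

open import Data.Nat as ℕ using (zero; z≤n; z<s; s<s; _+_)
import Data.Nat.Properties as ℕ
open import Data.Nat.Combinatorics using (nC1≡n; nCk+nC[k+1]≡[n+1]C[k+1])
open import Data.Fin using (zero; suc; toℕ; punchIn; punchOut; _≟_; _<_)
open import Data.Fin.Properties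
  using (+↔⊎; injective⇒≤; <-cmp; <⇒≢; ≤∧≢⇒<; <-asym; punchInᵢ≢i; punchIn-mono-≤; punchIn-injective;
         punchOut-mono-≤; punchOut-injective; punchIn-punchOut; punchOut-punchIn; suc-injective)
open import Data.Vec using (_∷_; []; lookup; removeAt)
open import Data.Vec.Properties using (removeAt-punchOut)
open import Data.Vec.Membership.Propositional using (_∈_)
open import Data.Vec.Membership.Propositional.Properties using (∈-lookup)
open import Data.Vec.Relation.Unary.Any using (here; there; index)
open import Data.Vec.Relation.Unary.Any.Properties using (lookup-index)
open import Data.Vec.Relation.Binary.Pointwise.Extensional using (ext; Pointwise-≡⇒≡)
open import Data.Product using (_,_; proj₁; proj₂; map; uncurry)
open import Data.Sum using (_⊎_; inj₁; inj₂)
open import Data.Unit using (⊤)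
open import Function using (_∘_; _↔_; Inverse; Injective)
open import Function.Bundles using (Injection)
open import Function.Properties.Inverse using (↔⇒↣)
open import Relation.Binary.Definitions using (Monotonic₁; tri<; tri≈; tri>)
open import Relation.Nullary using (yes; no; contradiction)
open import Relation.Binary.PropositionalEquality
  using (_≢_; _≗_; refl; sym; trans; cong; cong₂; subst; subst₂; module ≡-Reasoning)

-- Strictly increasing maps of finite ordinals

Increasing : ∀ {n m} → (Fin n → Fin m) → Set
Increasing = Monotonic₁ _<_ _<_

punchIn-mono-< : ∀ {n} (i : Fin (suc n)) {j k : Fin n} → j < k → punchIn i j < punchIn i k
punchIn-mono-< i j<k =
  ≤∧≢⇒< (punchIn-mono-≤ i _ _ (ℕ.<⇒≤ j<k)) (<⇒≢ j<k ∘ punchIn-injective i _ _)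

punchOut-mono-< : ∀ {n} {i j k : Fin (suc n)} (i≢j : i ≢ j) (i≢k : i ≢ k) →
                  j < k → punchOut i≢j < punchOut i≢k
punchOut-mono-< i≢j i≢k j<k =
  ≤∧≢⇒< (punchOut-mono-≤ i≢j i≢k (ℕ.<⇒≤ j<k)) (<⇒≢ j<k ∘ punchOut-injective i≢j i≢k)

increasing-injective : ∀ {n m} {g : Fin n → Fin m} → Increasing g → Injective _≡_ _≡_ g
increasing-injective inc {i} {j} gi≡gj with <-cmp i j
... | tri< i<j _ _ = contradiction gi≡gj (<⇒≢ (inc i<j))
... | tri≈ _ i≡j _ = i≡j
... | tri> _ _ j<i = contradiction (sym gi≡gj) (<⇒≢ (inc j<i))

module _ {n m} (g : Fin n → Fin (suc m)) (zero∉g : ∀ j → zero ≢ g j) where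

  lower : Fin n → Fin m
  lower j = punchOut (zero∉g j)

  suc∘lower : ∀ j → suc (lower j) ≡ g j
  suc∘lower j = punchIn-punchOut (zero∉g j)

  lower-increasing : Increasing g → Increasing lower
  lower-increasing inc i<j = punchOut-mono-< (zero∉g _) (zero∉g _) (inc i<j)

module _ {n m} {g : Fin (suc n) → Fin (suc m)} (inc : Increasing g) where

  zero∉tail : ∀ j → zero ≢ g (suc j)
  zero∉tail j = <⇒≢ (ℕ.≤-<-trans z≤n (inc z<s))

  zero∉image : g zero ≢ zero → ∀ j → zero ≢ g j
  zero∉image g0≢0 zero = g0≢0 ∘ sym
  zero∉image g0≢0 (suc j) = zero∉tail j

  lowerTail : Fin n → Fin m
  lowerTail = lower (g ∘ suc) zero∉tail

  suc∘lowerTail : ∀ j → suc (lowerTail j) ≡ g (suc j)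
  suc∘lowerTail = suc∘lower (g ∘ suc) zero∉tail

  lowerTail-increasing : Increasing lowerTail
  lowerTail-increasing = lower-increasing (g ∘ suc) zero∉tail (inc ∘ s<s)

increasing⇒≗id : ∀ {n} (g : Fin n → Fin n) → Increasing g → ∀ j → g j ≡ j
increasing⇒≗id {suc n} g inc j with g zero ≟ zero
... | no g0≢0 = contradiction (injective⇒≤ (increasing-injective lowered-increasing)) ℕ.1+n≰n
  where
    lowered-increasing : Increasing (lower g (zero∉image inc g0≢0))
    lowered-increasing = lower-increasing g (zero∉image inc g0≢0) inc
increasing⇒≗id g inc zero    | yes g0≡0 = g0≡0
increasing⇒≗id g inc (suc j) | yes _ =
  trans (sym (suc∘lowerTail inc j)) (cong suc (increasing⇒≗id _ (lowerTail-increasing inc) j))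

increasing⇒punchIn : ∀ {n} (g : Fin n → Fin (suc n)) → Increasing g → ∃[ m ] g ≗ punchIn m
increasing⇒punchIn {zero} g _ = zero , λ ()
increasing⇒punchIn {suc n} g inc with g zero ≟ zero
... | no g0≢0 = zero , λ j → trans (sym (suc∘lower g zero∉g j))
                                   (cong suc (increasing⇒≗id _ (lower-increasing g zero∉g inc) j))
  where zero∉g = zero∉image inc g0≢0
... | yes g0≡0 with increasing⇒punchIn _ (lowerTail-increasing inc)
...   | m , tail≗ = suc m , λ where
        zero    → g0≡0
        (suc j) → trans (sym (suc∘lowerTail inc j)) (cong suc (tail≗ j))

-- Both sides enumerate the complement of {a, b} in increasing order.
punchIn-punchIn-comm : ∀ {n} {a b : Fin (suc (suc n))} (a≢b : a ≢ b) (b≢a : b ≢ a) (j : Fin n) →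
                       punchIn a (punchIn (punchOut a≢b) j) ≡ punchIn b (punchIn (punchOut b≢a) j)
punchIn-punchIn-comm {a = zero}  {zero}  a≢b _ j = contradiction refl a≢b
punchIn-punchIn-comm {a = zero}  {suc b} _ _ j = refl
punchIn-punchIn-comm {a = suc a} {zero}  _ _ j = refl
punchIn-punchIn-comm {zero} {suc zero} {suc zero} a≢b _ j = contradiction refl a≢b
punchIn-punchIn-comm {suc n} {suc a} {suc b} _ _ zero = refl
punchIn-punchIn-comm {suc n} {suc a} {suc b} a≢b b≢a (suc j) =
  cong suc (punchIn-punchIn-comm (a≢b ∘ cong suc) (b≢a ∘ cong suc) j)

punchOut≤punchOut : ∀ {n} {a b : Fin (suc (suc n))} (b≢a : b ≢ a) (a≢b : a ≢ b) →
                    a < b → toℕ (punchOut b≢a) ≤ toℕ (punchOut a≢b)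
punchOut≤punchOut {a = zero} {suc b} _ _ _ = z≤n
punchOut≤punchOut {zero} {suc zero} {suc zero} _ _ (s<s ())
punchOut≤punchOut {suc n} {suc a} {suc b} b≢a a≢b (s<s a<b) =
  ℕ.s≤s (punchOut≤punchOut (b≢a ∘ cong suc) (a≢b ∘ cong suc) a<b)

-- Enumerating the pairs a < b in Fin m by Fin (m C 2)

suc-C2 : ∀ m → suc m C 2 ≡ m + m C 2
suc-C2 m = trans (sym (nCk+nC[k+1]≡[n+1]C[k+1] m 1)) (cong (_+ m C 2) (nC1≡n m))

suc-C2-↔ : ∀ m → Fin (suc m C 2) ↔ (Fin m ⊎ Fin (m C 2))
suc-C2-↔ m rewrite suc-C2 m = +↔⊎

pair : ∀ m → Fin (m C 2) → Fin m × Fin m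
pair-step : ∀ m → Fin m ⊎ Fin (m C 2) → Fin (suc m) × Fin (suc m)

pair (suc m) k = pair-step m (Inverse.to (suc-C2-↔ m) k)

pair-step m (inj₁ j) = zero , suc j
pair-step m (inj₂ k) = map suc suc (pair m k)

pair-< : ∀ m k → proj₁ (pair m k) < proj₂ (pair m k)
pair-< (suc m) k with Inverse.to (suc-C2-↔ m) k
... | inj₁ _ = z<s
... | inj₂ k = s<s (pair-< m k)

pair∘from : ∀ m x → pair (suc m) (Inverse.from (suc-C2-↔ m) x) ≡ pair-step m x
pair∘from m x = cong (pair-step m) (Inverse.strictlyInverseˡ (suc-C2-↔ m) x)

pair-injective : ∀ m → Injective _≡_ _≡_ (pair m)
pair-injective (suc m) eq = Injection.injective (↔⇒↣ (suc-C2-↔ m)) (step-injective _ _ eq)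
  where
    step-injective : ∀ x y → pair-step m x ≡ pair-step m y → x ≡ y
    step-injective (inj₁ _) (inj₁ _) refl = refl
    step-injective (inj₁ _) (inj₂ _) ()
    step-injective (inj₂ _) (inj₁ _) ()
    step-injective (inj₂ k) (inj₂ l) eq =
      cong inj₂ (pair-injective m (cong₂ _,_ (suc-injective (cong proj₁ eq))
                                             (suc-injective (cong proj₂ eq))))

pair-surjective : ∀ m {a b : Fin m} → a < b → ∃[ k ] pair m k ≡ (a , b)
pair-surjective (suc m) {zero} {suc b} _ = Inverse.from (suc-C2-↔ m) (inj₁ b) , pair∘from m (inj₁ b)
pair-surjective (suc m) {suc a} {suc b} (s<s a<b) with pair-surjective m a<b
... | k , pair≡ = Inverse.from (suc-C2-↔ m) (inj₂ k) , trans (pair∘from m (inj₂ k)) (cong (map suc suc) pair≡)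

-- Faces of vectors

module _ {A : Set} where

  Distinct : ∀ {n} → Vec A n → Set
  Distinct xs = ∀ i j → lookup xs i ≡ lookup xs j → i ≡ j

  lookup-removeAt : ∀ {n} (xs : Vec A (suc n)) i j → lookup (removeAt xs i) j ≡ lookup xs (punchIn i j)
  lookup-removeAt xs i j = begin
    lookup (removeAt xs i) j                                    ≡⟨ cong (lookup (removeAt xs i)) (sym (punchOut-punchIn i)) ⟩
    lookup (removeAt xs i) (punchOut (punchInᵢ≢i i j ∘ sym))   ≡⟨ removeAt-punchOut xs (punchInᵢ≢i i j ∘ sym) ⟩
    lookup xs (punchIn i j)                                     ∎
    where open ≡-Reasoning

  ∈⇒lookup : ∀ {n x} {xs : Vec A n} → x ∈ xs → ∃[ i ] lookup xs i ≡ x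
  ∈⇒lookup x∈ = index x∈ , sym (lookup-index x∈)

  lookup∈removeAt : ∀ {n} (xs : Vec A (suc n)) {c i} → c ≢ i → lookup xs i ∈ removeAt xs c
  lookup∈removeAt xs {c} c≢i = subst (_∈ removeAt xs c) (removeAt-punchOut xs c≢i) (∈-lookup _ _)

  ∈-removeAt⁻ : ∀ {n x} (xs : Vec A (suc n)) i → x ∈ removeAt xs i → x ∈ xs
  ∈-removeAt⁻ (_ ∷ _)          zero    x∈      = there x∈
  ∈-removeAt⁻ (_ ∷ _ ∷ _)      (suc i) (here x≡) = here x≡
  ∈-removeAt⁻ (_ ∷ xs@(_ ∷ _)) (suc i) (there x∈) = there (∈-removeAt⁻ xs i x∈)

  removeAt-removeAt-comm : ∀ {n} (xs : Vec A (suc (suc n))) {a b} (a≢b : a ≢ b) (b≢a : b ≢ a) →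
                           removeAt (removeAt xs a) (punchOut a≢b) ≡ removeAt (removeAt xs b) (punchOut b≢a)
  removeAt-removeAt-comm xs {a} {b} a≢b b≢a = Pointwise-≡⇒≡ (ext λ j → begin
    lookup (removeAt (removeAt xs a) (punchOut a≢b)) j  ≡⟨ lookup-removeAt (removeAt xs a) _ j ⟩
    lookup (removeAt xs a) (punchIn (punchOut a≢b) j)   ≡⟨ lookup-removeAt xs a _ ⟩
    lookup xs (punchIn a (punchIn (punchOut a≢b) j))    ≡⟨ cong (lookup xs) (punchIn-punchIn-comm a≢b b≢a j) ⟩
    lookup xs (punchIn b (punchIn (punchOut b≢a) j))    ≡⟨ lookup-removeAt xs b _ ⟨
    lookup (removeAt xs b) (punchIn (punchOut b≢a) j)   ≡⟨ lookup-removeAt (removeAt xs b) _ j ⟨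
    lookup (removeAt (removeAt xs b) (punchOut b≢a)) j  ∎)
    where open ≡-Reasoning

  module _ {n} (xs : Vec A (suc n)) (xs-distinct : Distinct xs) where

    lookup-removeAt-≢ : ∀ i j → lookup (removeAt xs i) j ≢ lookup xs i
    lookup-removeAt-≢ i j eq =
      punchInᵢ≢i i j (xs-distinct _ _ (trans (sym (lookup-removeAt xs i j)) eq))

    removeAt-injective : ∀ {i i′} → removeAt xs i ≡ removeAt xs i′ → i ≡ i′
    removeAt-injective {i} {i′} eq with i ≟ i′
    ... | yes i≡i′ = i≡i′
    ... | no i≢i′ = contradiction (begin
      lookup (removeAt xs i′) (punchOut i≢i′) ≡⟨ cong (λ ys → lookup ys (punchOut i≢i′)) eq ⟨
      lookup (removeAt xs i) (punchOut i≢i′)  ≡⟨ removeAt-punchOut xs i≢i′ ⟩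
      lookup xs i′                            ∎) (lookup-removeAt-≢ i′ _)
      where open ≡-Reasoning

  removeAt-removeAt-≡⇒lookup : ∀ {n} (xs : Vec A (suc (suc n))) → Distinct xs →
    ∀ {m m′ i i′} (m≢m′ : m ≢ m′) → removeAt (removeAt xs m) i ≡ removeAt (removeAt xs m′) i′ →
    lookup (removeAt xs m) i ≡ lookup xs m′
  removeAt-removeAt-≡⇒lookup xs xs-distinct {m} {m′} {i} {i′} m≢m′ eq with i ≟ punchOut m≢m′
  ... | yes refl = removeAt-punchOut xs m≢m′
  ... | no i≢i₀ = contradiction (begin
    lookup (removeAt xs m′) (punchIn i′ k)              ≡⟨ lookup-removeAt (removeAt xs m′) i′ k ⟨
    lookup (removeAt (removeAt xs m′) i′) k             ≡⟨ cong (λ ys → lookup ys k) eq ⟨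
    lookup (removeAt (removeAt xs m) i) k               ≡⟨ removeAt-punchOut (removeAt xs m) i≢i₀ ⟩
    lookup (removeAt xs m) (punchOut m≢m′)              ≡⟨ removeAt-punchOut xs m≢m′ ⟩
    lookup xs m′                                        ∎) (lookup-removeAt-≢ xs xs-distinct m′ (punchIn i′ k))
    where
      open ≡-Reasoning
      k = punchOut i≢i₀

  removeAt-removeAt-≡⇒lookup-swap : ∀ {n} (xs : Vec A (suc (suc n))) → Distinct xs →
    ∀ {m m′ i i′} → Distinct (removeAt xs m) → removeAt (removeAt xs m) i ≡ removeAt (removeAt xs m′) i′ →
    lookup (removeAt xs m) i ≢ lookup (removeAt xs m′) i′ →
    lookup (removeAt xs m) i ≡ lookup xs m′ × lookup (removeAt xs m′) i′ ≡ lookup xs m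
  removeAt-removeAt-≡⇒lookup-swap xs xs-distinct {m} {m′} ∂xs-distinct facet≡ vertices≢ =
    removeAt-removeAt-≡⇒lookup xs xs-distinct m≢m′ facet≡ ,
    removeAt-removeAt-≡⇒lookup xs xs-distinct (m≢m′ ∘ sym) (sym facet≡)
    where
      m≢m′ : m ≢ m′
      m≢m′ refl = vertices≢ (cong (lookup (removeAt xs m)) (removeAt-injective (removeAt xs m) ∂xs-distinct facet≡))

-- Simplices, faces and almost-simplices

module _ {V : Set} where

  Edg-removeAt⁻ : ∀ {n x y} (τ : Vec V (suc n)) c → Edg (removeAt τ c) x y → Edg τ x y
  Edg-removeAt⁻ τ c (i , j , i<j , τ∂i≡x , τ∂j≡y) =
    punchIn c i , punchIn c j , punchIn-mono-< c i<j ,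
    trans (sym (lookup-removeAt τ c i)) τ∂i≡x , trans (sym (lookup-removeAt τ c j)) τ∂j≡y

  Edg-removeAt⁺ : ∀ {n} (τ : Vec V (suc n)) {c i j} (c≢i : c ≢ i) (c≢j : c ≢ j) →
                  i < j → Edg (removeAt τ c) (lookup τ i) (lookup τ j)
  Edg-removeAt⁺ τ c≢i c≢j i<j =
    punchOut c≢i , punchOut c≢j , punchOut-mono-< c≢i c≢j i<j ,
    removeAt-punchOut τ c≢i , removeAt-punchOut τ c≢j

  Edg-lookup⁻ : ∀ {n} (τ : Vec V n) → Distinct τ → ∀ {a b} → Edg τ (lookup τ a) (lookup τ b) → a < b
  Edg-lookup⁻ τ τ-distinct (i , j , i<j , τi≡τa , τj≡τb) =
    subst₂ _<_ (τ-distinct _ _ τi≡τa) (τ-distinct _ _ τj≡τb) i<j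

  Edg-pair⁻ : ∀ {x y u w : V} → Edg (x ∷ y ∷ []) u w → u ≡ x × w ≡ y
  Edg-pair⁻ (zero , suc zero , _ , refl , refl) = refl , refl
  Edg-pair⁻ (suc zero , suc zero , s<s () , _)

  IsSimplexIn-removeAt : ∀ (Vp : V → Set) (Ep : V → V → Set) {n} (τ : Vec V (suc n)) →
                         IsSimplexIn Vp Ep τ → ∀ c → IsSimplexIn Vp Ep (removeAt τ c)
  IsSimplexIn-removeAt Vp Ep τ (τ-distinct , τ∈Vp , τ-edges) c =
      (λ i j eq → punchIn-injective c i j (τ-distinct _ _ (trans (sym (τ∂≡ i)) (trans eq (τ∂≡ j)))))
    , (λ i → subst Vp (sym (τ∂≡ i)) (τ∈Vp _))
    , (λ i j i<j → subst₂ Ep (sym (τ∂≡ i)) (sym (τ∂≡ j)) (τ-edges _ _ (punchIn-mono-< c i<j)))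
    where τ∂≡ = lookup-removeAt τ c

  module _ {d} (τ : Vec V (suc d)) (τ-distinct : Distinct τ) {σ : Vec V d}
           (σ⊆τ : ∀ v → v ∈ σ → v ∈ τ) (Eσ⊆Eτ : ∀ x y → Edg σ x y → Edg τ x y) where

    private
      position : Fin d → Fin (suc d)
      position j = proj₁ (∈⇒lookup (σ⊆τ _ (∈-lookup j σ)))

      lookup-position : ∀ j → lookup τ (position j) ≡ lookup σ j
      lookup-position j = proj₂ (∈⇒lookup (σ⊆τ _ (∈-lookup j σ)))

      position-increasing : Increasing position
      position-increasing {i} {j} i<j = Edg-lookup⁻ τ τ-distinct
        (subst₂ (Edg τ) (sym (lookup-position i)) (sym (lookup-position j)) (Eσ⊆Eτ _ _ (i , j , i<j , refl , refl)))

    subgraph⇒face : ∃[ m ] σ ≡ removeAt τ m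
    subgraph⇒face with increasing⇒punchIn position position-increasing
    ... | m , position≗ = m , Pointwise-≡⇒≡ (ext λ j → begin
      lookup σ j               ≡⟨ lookup-position j ⟨
      lookup τ (position j)    ≡⟨ cong (lookup τ) (position≗ j) ⟩
      lookup τ (punchIn m j)   ≡⟨ lookup-removeAt τ m j ⟨
      lookup (removeAt τ m) j  ∎)
      where open ≡-Reasoning

  -- τ with its edge (τ_a , τ_b) missing.
  almostFace : ∀ {d} → Vec V (suc d) → Fin (suc d) → Fin (suc d) → Pres d
  almostFace τ a b = pres (removeAt τ b) (removeAt τ a) (lookup τ a , lookup τ b)

  almostFace-contained : ∀ {d} (τ : Vec V (suc d)) {a b} → a < b → ContainedIn (almostFace τ a b) τ
  almostFace-contained τ {a} {b} a<b =
      (λ _ → ∈-removeAt⁻ τ b) , (λ _ → ∈-removeAt⁻ τ a)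
    , (λ _ _ → Edg-removeAt⁻ τ b) , (λ _ _ → Edg-removeAt⁻ τ a)
    , (_ , refl , ∈-lookup a τ , ∈-lookup b τ , (a , b , a<b , refl , refl))

  almostFace-completes : ∀ {d} (τ : Vec V (suc d)) → Distinct τ → ∀ {a b} → a < b →
                         CompletesTo (almostFace τ a b) τ
  almostFace-completes τ τ-distinct {a} {b} a<b = τ-distinct , spanVer , spanEdg
    where
      spanVer : ∀ i → SpanVer (almostFace τ a b) (lookup τ i)
      spanVer i with b ≟ i
      ... | no b≢i   = inj₁ (lookup∈removeAt τ b≢i)
      ... | yes refl = inj₂ (lookup∈removeAt τ (<⇒≢ a<b))

      spanEdg : ∀ i j → i < j → SpanEdg (almostFace τ a b) (lookup τ i) (lookup τ j)
      spanEdg i j i<j with b ≟ i | b ≟ j | a ≟ i | a ≟ j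
      ... | no b≢i | no b≢j | _      | _      = inj₁ (Edg-removeAt⁺ τ b≢i b≢j i<j)
      ... | _      | _      | no a≢i | no a≢j = inj₂ (inj₁ (Edg-removeAt⁺ τ a≢i a≢j i<j))
      ... | _      | yes b≡j | yes a≡i | _    = inj₂ (inj₂ (cong₂ _,_ (cong (lookup τ) a≡i) (cong (lookup τ) b≡j)))
      ... | yes refl | _    | yes refl | _    = contradiction refl (<⇒≢ a<b)
      ... | _      | yes refl | _   | yes refl = contradiction refl (<⇒≢ a<b)
      ... | yes refl | _    | _     | yes refl = contradiction a<b (<-asym i<j)

  almostFace-isAlmost : ∀ (E : V → V → Set) {d} (τ : Vec V (suc (suc d))) →
                        IsSimplexIn (λ _ → ⊤) E τ → ∀ {a b} → a < b → AlmostCond E (almostFace τ a b)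
  almostFace-isAlmost E {zero} (_ ∷ _ ∷ []) (τ-distinct , _) {zero} {suc zero} _ =
    (λ x≡y → contradiction (τ-distinct zero (suc zero) x≡y) λ ()) , inj₁ refl
  almostFace-isAlmost E {zero} (_ ∷ _ ∷ []) _ {suc zero} {suc zero} (s<s ())
  almostFace-isAlmost E {suc d} τ τ-simplex@(τ-distinct , _) {a} {b} a<b =
      IsSimplexIn-removeAt (λ _ → ⊤) E τ τ-simplex b , IsSimplexIn-removeAt (λ _ → ⊤) E τ τ-simplex a
    , punchOut b≢a , punchOut a≢b , removeAt-removeAt-comm τ b≢a a≢b
    , (λ eq → a≢b (τ-distinct _ _ (trans (sym τa≡) (trans eq τb≡))))
    , inj₁ (cong₂ _,_ (sym τa≡) (sym τb≡) , punchOut≤punchOut b≢a a≢b a<b)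
    where
      a≢b = <⇒≢ a<b
      b≢a = a≢b ∘ sym
      τa≡ = removeAt-punchOut τ b≢a
      τb≡ = removeAt-punchOut τ a≢b

  almostFace-injective : ∀ {d} (τ : Vec V (suc d)) → Distinct τ → ∀ {a b a′ b′} →
                         SameAlmost (almostFace τ a b) (almostFace τ a′ b′) → (a , b) ≡ (a′ , b′)
  almostFace-injective τ τ-distinct (_ , e≡) =
    cong₂ _,_ (τ-distinct _ _ (cong proj₁ e≡)) (τ-distinct _ _ (cong proj₂ e≡))

  ContainedIn⇒Edg : ∀ {d n} {p : Pres d} {τ : Vec V n} → ContainedIn p τ →
                      ∀ {x y} → e p ≡ (x , y) → Edg τ x y
  ContainedIn⇒Edg {τ = τ} (_ , _ , _ , _ , _ , e≡ , _ , _ , Exy) eq =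
    subst (uncurry (Edg τ)) (trans (sym e≡) eq) Exy

  contained⇒almostFace : ∀ (E : V → V → Set) {d} (τ : Vec V (suc (suc d))) → Distinct τ →
    (p : Pres (suc d)) → AlmostCond E p → ContainedIn p τ →
    ∃[ a ] ∃[ b ] (a < b × SameAlmost p (almostFace τ a b))
  contained⇒almostFace E {zero} (_ ∷ _ ∷ []) _ (pres (_ ∷ []) (_ ∷ []) _) (_ , e-cases) p⊆τ
    with Edg-pair⁻ (ContainedIn⇒Edg p⊆τ refl) | e-cases
  ... | refl , refl | inj₁ refl = zero , suc zero , z<s , inj₁ (refl , refl) , refl
  ... | refl , refl | inj₂ refl = zero , suc zero , z<s , inj₂ (refl , refl) , refl
  contained⇒almostFace E {suc d} τ τ-distinct (pres σ σ′ e)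
    (σ-simplex , _ , i , i′ , facet≡ , σi≢σ′i′ , e-cases) p⊆τ@(σ⊆τ , σ′⊆τ , Eσ⊆Eτ , Eσ′⊆Eτ , _)
    with subgraph⇒face τ τ-distinct σ⊆τ Eσ⊆Eτ | subgraph⇒face τ τ-distinct σ′⊆τ Eσ′⊆Eτ
  ... | m , refl | m′ , refl
    with removeAt-removeAt-≡⇒lookup-swap τ τ-distinct (proj₁ σ-simplex) facet≡ σi≢σ′i′ | e-cases
  ... | σi≡τm′ , σ′i′≡τm | inj₁ (e≡ , _) =
    m′ , m , Edg-lookup⁻ τ τ-distinct (ContainedIn⇒Edg p⊆τ e≡τm′τm) , inj₁ (refl , refl) , e≡τm′τm
    where e≡τm′τm = trans e≡ (cong₂ _,_ σi≡τm′ σ′i′≡τm)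
  ... | σi≡τm′ , σ′i′≡τm | inj₂ (e≡ , _) =
    m , m′ , Edg-lookup⁻ τ τ-distinct (ContainedIn⇒Edg p⊆τ e≡τmτm′) , inj₂ (refl , refl) , e≡τmτm′
    where e≡τmτm′ = trans e≡ (cong₂ _,_ σ′i′≡τm σi≡τm′)

lemma2 : (G : SimpleDigraph) (d : ℕ) → 1 ≤ d
    → (σ̄ : Vec (Fin (SimpleDigraph.n G)) (suc d)) → IsSimplex G σ̄
    → Σ (Fin (suc d C 2) → Pres d) λ f
        → (∀ k → IsAlmostSimplex G (f k) × ContainedIn (f k) σ̄ × CompletesTo (f k) σ̄)
        × (∀ k l → SameAlmost (f k) (f l) → k ≡ l)
        × (∀ p → IsAlmostSimplex G p → ContainedIn p σ̄ → CompletesTo p σ̄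
             → ∃[ k ] SameAlmost p (f k))
lemma2 G (suc d) _ τ τ-simplex@(τ-distinct , _) =
    face ∘ pair (suc (suc d))
  , (λ k → almostFace-isAlmost E τ τ-simplex (pair-< (suc (suc d)) k)
         , almostFace-contained τ (pair-< (suc (suc d)) k)
         , almostFace-completes τ τ-distinct (pair-< (suc (suc d)) k))
  , (λ k l same → pair-injective (suc (suc d)) (almostFace-injective τ τ-distinct same))
  , classified
  where
    E = SimpleDigraph.E G

    face : Fin (suc (suc d)) × Fin (suc (suc d)) → Pres (suc d)
    face = uncurry (almostFace τ)

    -- Containment in τ alone already pins p down.
    classified : ∀ p → IsAlmostSimplex G p → ContainedIn p τ → CompletesTo p τ →
                 ∃[ k ] SameAlmost p (face (pair (suc (suc d)) k))
    classified p p-almost p⊆τ _ with contained⇒almostFace E τ τ-distinct p p-almost p⊆τ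
    ... | a , b , a<b , same with pair-surjective (suc (suc d)) a<b
    ... | k , pair≡ = k , subst (SameAlmost p ∘ face) (sym pair≡) same
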